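{- Let $G$ be a graph and let $K$ be (the vertex set of) a maximal clique of $G$. Then $\log_2(\mathrm{dn}(K)+2)\le|\widetilde{K}|\le 2^{\mathrm{dn}(K)}$.
   Context: All graphs finite and simple. Two vertices are equivalent if they lie in exactly the same maximal cliques of $G$ (true twins); $\widetilde{K}$ denotes the set of equivalence classes intersecting $K$. For $X\subseteq V(G)$, $N(X)$ is the set of vertices outside $X$ with a neighbour in $X$. A set $Y\subseteq N(X)$ is $X$-diverse if $N(y_1)\cap X\neq N(y_2)\cap X$ for all distinct $y_1,y_2\in Y$; the diversity number $\mathrm{dn}(X)$ is the maximum size of an $X$-diverse set. -}

module Defs where

open import Data.Nat using (ℕ; _≤_)
open import Data.Bool using (Bool; true; false)
open import Data.Fin using (Fin)
open import Data.Fin.Subset using (Subset; _∈_; _∉_; _⊆_; ∣_∣)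
open import Data.Product using (Σ; _×_)
open import Relation.Binary.PropositionalEquality using (_≡_; _≢_)
open import Relation.Nullary using (¬_)

record Graph (n : ℕ) : Set where
  field
    adj   : Fin n → Fin n → Bool
    sym   : ∀ x y → adj x y ≡ adj y x
    irrefl : ∀ x → adj x x ≡ false

module _ {n : ℕ} (G : Graph n) where
  open Graph G

  Adj : Fin n → Fin n → Set
  Adj x y = adj x y ≡ true

  IsClique : Subset n → Set
  IsClique K = ∀ x y → x ∈ K → y ∈ K → x ≢ y → Adj x y

  IsMaximalClique : Subset n → Set
  IsMaximalClique K = IsClique K × (∀ K' → IsClique K' → K ⊆ K' → K' ⊆ K)

  Equiv : Fin n → Fin n → Set
  Equiv x y = ∀ C → IsMaximalClique C → (x ∈ C → y ∈ C) × (y ∈ C → x ∈ C)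

  InN : Subset n → Fin n → Set
  InN X v = v ∉ X × Σ (Fin n) (λ u → u ∈ X × Adj v u)

  SameTrace : Subset n → Fin n → Fin n → Set
  SameTrace X y₁ y₂ = ∀ x → x ∈ X → (Adj y₁ x → Adj y₂ x) × (Adj y₂ x → Adj y₁ x)

  IsDiverse : Subset n → Subset n → Set
  IsDiverse X Y = (∀ y → y ∈ Y → InN X y)
                × (∀ y₁ y₂ → y₁ ∈ Y → y₂ ∈ Y → y₁ ≢ y₂ → ¬ SameTrace X y₁ y₂)

  IsDiversityNumber : Subset n → ℕ → Set
  IsDiversityNumber X d =
    Σ (Subset n) (λ Y → IsDiverse X Y × ∣ Y ∣ ≡ d)
    × (∀ Y → IsDiverse X Y → ∣ Y ∣ ≤ d)

  -- k = |K̃|: the number of true-twin classes meeting K, witnessed by a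
  -- complete system of pairwise inequivalent representatives r : Fin k → K.
  IsClassCount : Subset n → ℕ → Set
  IsClassCount K k =
    Σ (Fin k → Fin n) (λ r →
        (∀ i → r i ∈ K)
      × (∀ i j → Equiv (r i) (r j) → i ≡ j)
      × (∀ v → v ∈ K → Σ (Fin k) (λ i → Equiv v (r i))))

module Submission where

-- Let Y be a maximum K-diverse set. Since Y is maximum, every neighbour w of K has the same
-- trace on K as some y ∈ Y. If two vertices u, v of K are not twins, some maximal clique C
-- contains u but not v; maximality of C gives w ∈ C not adjacent to v, and the y representing
-- w separates u from v. So twin classes of K are told apart by their neighbourhoods in Y:
-- |K̃| ≤ 2^|Y|. Conversely, a vertex y outside K sees either all or none of each twin class
-- of K, so the K-trace of y is a set of classes; on a diverse set these sets are distinct,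
-- nonempty, and never all of K̃ (else K ∪ {y} is a clique): |Y| ≤ 2^|K̃| − 2.

open import Defs
open import Data.Nat using (ℕ; _≤_; _+_; _^_)
open import Data.Fin.Subset using (Subset)
open import Data.Product using (_×_)

open import Data.Nat using (zero; suc; _<_; z≤n; s≤s)
open import Data.Nat.Properties
  using (≤-trans; <-irrefl; ≤-reflexive; +-comm; +-suc; m≤m+n; +-monoʳ-≤; module ≤-Reasoning)
open import Data.Bool using (Bool; true; false) renaming (_≟_ to _≟ᵇ_)
open import Data.Fin using (Fin; combine; _≟_)
open import Data.Fin.Properties using (suc-injective; any?; all?; ¬∀⟶∃¬; injective⇒≤; combine-injective)
open import Data.Fin.Subset using (_∈_; _∉_; _⊆_; ∣_∣; ⊤; ⁅_⁆; _∪_; _-_; inside; outside)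
  renaming (⊥ to ∅)
open import Data.Fin.Subset.Properties
  using (_∈?_; ∈⊤; ∉⊥; ∣⊤∣≡n; x∈⁅x⁆; x∈⁅y⁆⇒x≡y; p⊆p∪q; x∈p∪q⁻; x∈p∪q⁺; ∣p∣≤n; p⊂q⇒∣p∣<∣q∣;
         x∈p∧x≢y⇒x∈p-y; x∈p⇒∣p-x∣<∣p∣)
open import Data.Vec using ([]; _∷_; tabulate; here; there)
open import Data.Vec.Properties using (lookup∘tabulate; []=⇒lookup; lookup⇒[]=; ∷-injective)
open import Data.Product using (∃; _,_; proj₁; proj₂)
open import Data.Sum using (_⊎_; inj₁; inj₂)
open import Data.Empty using (⊥-elim)
open import Function using (_∘_; case_of_)
open import Function.Definitions using (Injective)
open import Relation.Nullary using (Dec; yes; no; ¬_; ¬?)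
open import Relation.Nullary.Decidable using (_×-dec_; _→-dec_)
open import Relation.Binary.PropositionalEquality

private
  variable
    m k : ℕ

∈∧∉⇒≢ : ∀ {x y : Fin m} {p : Subset m} → x ∈ p → y ∉ p → x ≢ y
∈∧∉⇒≢ x∈p y∉p refl = y∉p x∈p

∈-∪⁅⁆⁻ : ∀ {x w : Fin m} (p : Subset m) → x ∈ p ∪ ⁅ w ⁆ → x ∈ p ⊎ x ≡ w
∈-∪⁅⁆⁻ {w = w} p x∈ with x∈p∪q⁻ p ⁅ w ⁆ x∈
... | inj₁ x∈p = inj₁ x∈p
... | inj₂ x∈w = inj₂ (x∈⁅y⁆⇒x≡y w x∈w)

w∈p∪⁅w⁆ : ∀ (p : Subset m) w → w ∈ p ∪ ⁅ w ⁆
w∈p∪⁅w⁆ p w = x∈p∪q⁺ (inj₂ (x∈⁅x⁆ w))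

x∉p⇒∣p∣<∣p∪⁅x⁆∣ : ∀ {p : Subset m} {x} → x ∉ p → ∣ p ∣ < ∣ p ∪ ⁅ x ⁆ ∣
x∉p⇒∣p∣<∣p∪⁅x⁆∣ {p = p} {x} x∉p = p⊂q⇒∣p∣<∣q∣ (p⊆p∪q ⁅ x ⁆ , x , w∈p∪⁅w⁆ p x , x∉p)

∈-tabulate⁺ : ∀ (f : Fin m → Bool) {x} → f x ≡ true → x ∈ tabulate f
∈-tabulate⁺ f {x} fx = lookup⇒[]= x _ (trans (lookup∘tabulate f x) fx)

∈-tabulate⁻ : ∀ (f : Fin m → Bool) {x} → x ∈ tabulate f → f x ≡ true
∈-tabulate⁻ f {x} x∈ = trans (sym (lookup∘tabulate f x)) ([]=⇒lookup x∈)

toBit : Bool → Fin 2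
toBit false = Fin.zero
toBit true  = Fin.suc Fin.zero

toBit-injective : Injective _≡_ _≡_ toBit
toBit-injective {false} {false} _ = refl
toBit-injective {true}  {true}  _ = refl

subsetToFin : Subset m → Fin (2 ^ m)
subsetToFin []      = Fin.zero
subsetToFin (b ∷ p) = combine (toBit b) (subsetToFin p)

subsetToFin-injective : Injective _≡_ _≡_ (subsetToFin {m})
subsetToFin-injective {x = []}    {[]}    _ = refl
subsetToFin-injective {x = b ∷ p} {c ∷ q} e with combine-injective _ _ _ _ e
... | b≡c , p≡q = cong₂ _∷_ (toBit-injective b≡c) (subsetToFin-injective p≡q)

restrict : (p : Subset m) → Subset m → Subset ∣ p ∣
restrict []            []      = []
restrict (outside ∷ p) (_ ∷ q) = restrict p q
restrict (inside  ∷ p) (b ∷ q) = b ∷ restrict p q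

restrict-≡⇒∈ : ∀ (p q q′ : Subset m) → restrict p q ≡ restrict p q′ →
               ∀ {x} → x ∈ p → x ∈ q → x ∈ q′
restrict-≡⇒∈ (outside ∷ p) (_ ∷ q) (_ ∷ q′) e (there x∈p) (there x∈q) =
  there (restrict-≡⇒∈ p q q′ e x∈p x∈q)
restrict-≡⇒∈ (inside ∷ p) (b ∷ q) (c ∷ q′) e here here
  rewrite proj₁ (∷-injective e) = here
restrict-≡⇒∈ (inside ∷ p) (b ∷ q) (c ∷ q′) e (there x∈p) (there x∈q) =
  there (restrict-≡⇒∈ p q q′ (proj₂ (∷-injective e)) x∈p x∈q)

injectiveOn⇒∣p∣≤∣q∣ : ∀ {m′} (p : Subset m) (q : Subset m′) (f : Fin m → Fin m′) →
  (∀ {i} → i ∈ p → f i ∈ q) → (∀ {i j} → i ∈ p → j ∈ p → f i ≡ f j → i ≡ j) →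
  ∣ p ∣ ≤ ∣ q ∣
injectiveOn⇒∣p∣≤∣q∣ []            q f maps inj = z≤n
injectiveOn⇒∣p∣≤∣q∣ (outside ∷ p) q f maps inj =
  injectiveOn⇒∣p∣≤∣q∣ p q (f ∘ Fin.suc) (maps ∘ there)
    (λ i∈p j∈p → suc-injective ∘ inj (there i∈p) (there j∈p))
injectiveOn⇒∣p∣≤∣q∣ (inside ∷ p) q f maps inj =
  ≤-trans (s≤s (injectiveOn⇒∣p∣≤∣q∣ p (q - f Fin.zero) (f ∘ Fin.suc) maps′ inj′))
          (x∈p⇒∣p-x∣<∣p∣ (maps here))
  where
  maps′ : ∀ {i} → i ∈ p → f (Fin.suc i) ∈ q - f Fin.zero
  maps′ i∈p = x∈p∧x≢y⇒x∈p-y (maps (there i∈p)) (λ e → case inj (there i∈p) here e of λ ())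
  inj′ : ∀ {i j} → i ∈ p → j ∈ p → f (Fin.suc i) ≡ f (Fin.suc j) → i ≡ j
  inj′ i∈p j∈p = suc-injective ∘ inj (there i∈p) (there j∈p)

injectiveOn-avoiding⇒∣p∣+2≤ : ∀ {m′} (p : Subset m) (f : Fin m → Fin m′) {a b : Fin m′} →
  a ≢ b → (∀ {i} → i ∈ p → f i ≢ a × f i ≢ b) →
  (∀ {i j} → i ∈ p → j ∈ p → f i ≡ f j → i ≡ j) → ∣ p ∣ + 2 ≤ m′
injectiveOn-avoiding⇒∣p∣+2≤ {m′ = m′} p f {a} {b} a≢b avoids inj = begin
  ∣ p ∣ + 2                   ≡⟨ +-comm ∣ p ∣ 2 ⟩
  suc (suc ∣ p ∣)             ≤⟨ s≤s (s≤s (injectiveOn⇒∣p∣≤∣q∣ p (⊤ - a - b) f maps inj)) ⟩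
  suc (suc ∣ ⊤ - a - b ∣)     ≤⟨ s≤s (x∈p⇒∣p-x∣<∣p∣ (x∈p∧x≢y⇒x∈p-y ∈⊤ (a≢b ∘ sym))) ⟩
  suc ∣ ⊤ - a ∣               ≤⟨ x∈p⇒∣p-x∣<∣p∣ {x = a} {p = ⊤ {m′}} ∈⊤ ⟩
  ∣ ⊤ {m′} ∣                  ≡⟨ ∣⊤∣≡n m′ ⟩
  m′                          ∎
  where
  open ≤-Reasoning
  maps : ∀ {i} → i ∈ p → f i ∈ ⊤ - a - b
  maps i∈p = x∈p∧x≢y⇒x∈p-y (x∈p∧x≢y⇒x∈p-y ∈⊤ (proj₁ (avoids i∈p))) (proj₂ (avoids i∈p))

module _ {n : ℕ} (G : Graph n) where
  open Graph G using (adj)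

  Adj? : ∀ x y → Dec (Adj G x y)
  Adj? x y = adj x y ≟ᵇ true

  Adj-sym : ∀ {x y} → Adj G x y → Adj G y x
  Adj-sym {x} {y} = trans (Graph.sym G y x)

  neighbourhood : Fin n → Subset n
  neighbourhood v = tabulate (λ y → adj y v)

  ⁅⁆-isClique : ∀ v → IsClique G ⁅ v ⁆
  ⁅⁆-isClique v x y x∈ y∈ x≢y = ⊥-elim (x≢y (trans (x∈⁅y⁆⇒x≡y v x∈) (sym (x∈⁅y⁆⇒x≡y v y∈))))

  ∪⁅⁆-isClique : ∀ {C w} → IsClique G C → (∀ x → x ∈ C → x ≢ w → Adj G w x) →
                 IsClique G (C ∪ ⁅ w ⁆)
  ∪⁅⁆-isClique {C} clique w~C x y x∈ y∈ x≢y with ∈-∪⁅⁆⁻ C x∈ | ∈-∪⁅⁆⁻ C y∈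
  ... | inj₁ x∈C | inj₁ y∈C = clique x y x∈C y∈C x≢y
  ... | inj₁ x∈C | inj₂ refl = Adj-sym (w~C x x∈C x≢y)
  ... | inj₂ refl | inj₁ y∈C = w~C y y∈C (x≢y ∘ sym)
  ... | inj₂ refl | inj₂ refl = ⊥-elim (x≢y refl)

  commonNeighbour? : ∀ C → Dec (∃ λ w → w ∉ C × ∀ x → x ∈ C → Adj G w x)
  commonNeighbour? C = any? (λ w → ¬? (w ∈? C) ×-dec all? (λ x → x ∈? C →-dec Adj? w x))

  ¬commonNeighbour⇒maximal : ∀ {C} → IsClique G C →
    ¬ (∃ λ w → w ∉ C × ∀ x → x ∈ C → Adj G w x) → IsMaximalClique G C
  ¬commonNeighbour⇒maximal {C} clique ∄w = clique , maximal
    where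
    maximal : ∀ C′ → IsClique G C′ → C ⊆ C′ → C′ ⊆ C
    maximal C′ clique′ C⊆C′ {w} w∈C′ with w ∈? C
    ... | yes w∈C = w∈C
    ... | no  w∉C = ⊥-elim (∄w (w , w∉C , λ x x∈C →
                      clique′ w x w∈C′ (C⊆C′ x∈C) (∈∧∉⇒≢ x∈C w∉C ∘ sym)))

  -- Each extension step enlarges the clique, so fuel n suffices.
  extendToMaximalClique : ∀ {C} → IsClique G C → ∃ λ M → IsMaximalClique G M × C ⊆ M
  extendToMaximalClique {C} = extend n (m≤m+n n ∣ C ∣)
    where
    extend : ∀ fuel {C} → n ≤ fuel + ∣ C ∣ → IsClique G C → ∃ λ M → IsMaximalClique G M × C ⊆ M
    extend fuel {C} bound clique with commonNeighbour? C
    ... | no ∄w = C , ¬commonNeighbour⇒maximal clique ∄w , λ x∈C → x∈C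
    ... | yes (w , w∉C , w~C) with fuel
    ...   | zero = ⊥-elim (<-irrefl refl (≤-trans (s≤s bound)
                     (≤-trans (x∉p⇒∣p∣<∣p∪⁅x⁆∣ w∉C) (∣p∣≤n (C ∪ ⁅ w ⁆)))))
    ...   | suc fuel′ with extend fuel′ bound′ (∪⁅⁆-isClique clique (λ x x∈C _ → w~C x x∈C))
      where
      bound′ : n ≤ fuel′ + ∣ C ∪ ⁅ w ⁆ ∣
      bound′ = ≤-trans bound (≤-trans (≤-reflexive (sym (+-suc fuel′ ∣ C ∣)))
                                      (+-monoʳ-≤ fuel′ (x∉p⇒∣p∣<∣p∪⁅x⁆∣ w∉C)))
    ...     | M , M-maximal , C∪w⊆M = M , M-maximal , C∪w⊆M ∘ p⊆p∪q ⁅ w ⁆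

  maximalClique-∉⇒nonNeighbour : ∀ {C v} → IsMaximalClique G C → v ∉ C →
                                 ∃ λ w → w ∈ C × ¬ Adj G w v
  maximalClique-∉⇒nonNeighbour {C} {v} (clique , maximal) v∉C
    with all? (λ w → w ∈? C →-dec Adj? w v)
  ... | yes v~C = ⊥-elim (v∉C (maximal (C ∪ ⁅ v ⁆)
          (∪⁅⁆-isClique clique (λ x x∈C _ → Adj-sym (v~C x x∈C))) (p⊆p∪q ⁅ v ⁆) (w∈p∪⁅w⁆ C v)))
  ... | no ¬v~C with ¬∀⟶∃¬ n _ (λ w → w ∈? C →-dec Adj? w v) ¬v~C
  ...   | w , ¬[w∈C⇒w~v] with w ∈? C
  ...     | yes w∈C = w , w∈C , λ w~v → ¬[w∈C⇒w~v] (λ _ → w~v)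
  ...     | no  w∉C = ⊥-elim (¬[w∈C⇒w~v] (⊥-elim ∘ w∉C))

  maximalClique-nonempty : ∀ {K} → IsMaximalClique G K → Fin n → ∃ λ v → v ∈ K
  maximalClique-nonempty {K} K-maximal v with v ∈? K
  ... | yes v∈K = v , v∈K
  ... | no  v∉K = let w , w∈K , _ = maximalClique-∉⇒nonNeighbour K-maximal v∉K in w , w∈K

  Equiv-sym : ∀ {u v} → Equiv G u v → Equiv G v u
  Equiv-sym u≈v C C-maximal = proj₂ (u≈v C C-maximal) , proj₁ (u≈v C C-maximal)

  -- Extend the edge yu to a maximal clique; it contains v as well.
  Adj-respʳ-Equiv : ∀ {y u v} → Equiv G u v → y ≢ v → Adj G y u → Adj G y v
  Adj-respʳ-Equiv {y} {u} {v} u≈v y≢v y~u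
    with extendToMaximalClique (∪⁅⁆-isClique (⁅⁆-isClique y) λ x x∈y _ →
           subst (λ x → Adj G u x) (sym (x∈⁅y⁆⇒x≡y y x∈y)) (Adj-sym y~u))
  ... | M , M-maximal@(M-clique , _) , yu⊆M =
    M-clique y v (yu⊆M (p⊆p∪q ⁅ u ⁆ (x∈⁅x⁆ y)))
                 (proj₁ (u≈v M M-maximal) (yu⊆M (w∈p∪⁅w⁆ ⁅ y ⁆ u))) y≢v

  SameTrace-sym : ∀ {X a b} → SameTrace G X a b → SameTrace G X b a
  SameTrace-sym a≈b x x∈X = proj₂ (a≈b x x∈X) , proj₁ (a≈b x x∈X)

  SameTrace? : ∀ X a b → Dec (SameTrace G X a b)
  SameTrace? X a b =
    all? (λ x → x ∈? X →-dec ((Adj? a x →-dec Adj? b x) ×-dec (Adj? b x →-dec Adj? a x)))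

  ∪⁅⁆-isDiverse : ∀ {X Y w} → IsDiverse G X Y → InN G X w →
                  (∀ y → y ∈ Y → ¬ SameTrace G X w y) → IsDiverse G X (Y ∪ ⁅ w ⁆)
  ∪⁅⁆-isDiverse {X} {Y} {w} (Y⊆N , Y-sep) w∈N w≉Y = Y∪w⊆N , Y∪w-sep
    where
    Y∪w⊆N : ∀ y → y ∈ Y ∪ ⁅ w ⁆ → InN G X y
    Y∪w⊆N y y∈ with ∈-∪⁅⁆⁻ Y y∈
    ... | inj₁ y∈Y = Y⊆N y y∈Y
    ... | inj₂ refl = w∈N
    Y∪w-sep : ∀ y₁ y₂ → y₁ ∈ Y ∪ ⁅ w ⁆ → y₂ ∈ Y ∪ ⁅ w ⁆ → y₁ ≢ y₂ → ¬ SameTrace G X y₁ y₂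
    Y∪w-sep y₁ y₂ y₁∈ y₂∈ y₁≢y₂ with ∈-∪⁅⁆⁻ Y y₁∈ | ∈-∪⁅⁆⁻ Y y₂∈
    ... | inj₁ y₁∈Y | inj₁ y₂∈Y = Y-sep y₁ y₂ y₁∈Y y₂∈Y y₁≢y₂
    ... | inj₁ y₁∈Y | inj₂ refl = w≉Y y₁ y₁∈Y ∘ SameTrace-sym
    ... | inj₂ refl | inj₁ y₂∈Y = w≉Y y₂ y₂∈Y
    ... | inj₂ refl | inj₂ refl = ⊥-elim (y₁≢y₂ refl)

  maximumDiverse-covers : ∀ {X Y w} → IsDiverse G X Y →
    (∀ Y′ → IsDiverse G X Y′ → ∣ Y′ ∣ ≤ ∣ Y ∣) → InN G X w →
    ∃ λ y → y ∈ Y × SameTrace G X w y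
  maximumDiverse-covers {X} {Y} {w} Y-diverse Y-maximum w∈N
    with any? (λ y → y ∈? Y ×-dec SameTrace? X w y)
  ... | yes covered = covered
  ... | no ∄y = ⊥-elim (<-irrefl refl (≤-trans (x∉p⇒∣p∣<∣p∪⁅x⁆∣ w∉Y)
                  (Y-maximum (Y ∪ ⁅ w ⁆) (∪⁅⁆-isDiverse Y-diverse w∈N λ y y∈Y w≈y → ∄y (y , y∈Y , w≈y)))))
    where
    w∉Y : w ∉ Y
    w∉Y w∈Y = ∄y (w , w∈Y , λ _ _ → (λ a → a) , (λ a → a))

  -- A maximal clique C ∌ v containing u has a vertex w ≁ v; w is then a neighbour of K,
  -- and its representative in Y is adjacent to u but not to v.
  maximumDiverse-separates : ∀ {K Y u v} → IsMaximalClique G K → IsDiverse G K Y →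
    (∀ Y′ → IsDiverse G K Y′ → ∣ Y′ ∣ ≤ ∣ Y ∣) → u ∈ K → v ∈ K →
    (∀ y → y ∈ Y → Adj G y u → Adj G y v) → ∀ C → IsMaximalClique G C → u ∈ C → v ∈ C
  maximumDiverse-separates {K} {Y} {u} {v} (K-clique , _) Y-diverse Y-maximum u∈K v∈K Y~u⇒Y~v
                           C C-maximal@(C-clique , _) u∈C
    with v ∈? C
  ... | yes v∈C = v∈C
  ... | no  v∉C with u ≟ v
  ...   | yes refl = u∈C
  ...   | no  u≢v = let w , w∈C , w≁v = maximalClique-∉⇒nonNeighbour C-maximal v∉C
                     in ⊥-elim (¬nonNeighbour w∈C w≁v)
    where
    ¬nonNeighbour : ∀ {w} → w ∈ C → ¬ ¬ Adj G w v
    ¬nonNeighbour {w} w∈C w≁v =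
      let y , y∈Y , w≈y = maximumDiverse-covers Y-diverse Y-maximum (w∉K , u , u∈K , w~u)
      in w≁v (proj₂ (w≈y v v∈K) (Y~u⇒Y~v y y∈Y (proj₁ (w≈y u u∈K) w~u)))
      where
      w~u : Adj G w u
      w~u = C-clique w u w∈C u∈C λ { refl → w≁v (K-clique u v u∈K v∈K u≢v) }
      w∉K : w ∉ K
      w∉K w∈K = w≁v (K-clique w v w∈K v∈K (∈∧∉⇒≢ w∈C v∉C))

  -- Representatives with the same neighbours in Y are twins, so their traces on Y are distinct.
  classCount≤2^∣maximumDiverse∣ : ∀ {K Y} → IsMaximalClique G K → IsDiverse G K Y →
    (∀ Y′ → IsDiverse G K Y′ → ∣ Y′ ∣ ≤ ∣ Y ∣) → IsClassCount G K k → k ≤ 2 ^ ∣ Y ∣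
  classCount≤2^∣maximumDiverse∣ {k} {K} {Y} K-maximal Y-diverse Y-maximum (r , r∈K , r-inj , _) =
    injective⇒≤ code-injective
    where
    code : Fin k → Fin (2 ^ ∣ Y ∣)
    code i = subsetToFin (restrict Y (neighbourhood (r i)))
    code≡⇒Y~r⇒Y~r : ∀ {i j} → code i ≡ code j → ∀ y → y ∈ Y → Adj G y (r i) → Adj G y (r j)
    code≡⇒Y~r⇒Y~r e y y∈Y =
      ∈-tabulate⁻ _ ∘ restrict-≡⇒∈ Y _ _ (subsetToFin-injective e) y∈Y ∘ ∈-tabulate⁺ _
    code-injective : Injective _≡_ _≡_ code
    code-injective {i} {j} e = r-inj i j λ C C-maximal →
      maximumDiverse-separates K-maximal Y-diverse Y-maximum (r∈K i) (r∈K j) (code≡⇒Y~r⇒Y~r e) C C-maximal ,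
      maximumDiverse-separates K-maximal Y-diverse Y-maximum (r∈K j) (r∈K i) (code≡⇒Y~r⇒Y~r (sym e)) C C-maximal

  -- Outside K adjacency to a vertex of K depends only on its twin class, so y ↦ (classes
  -- adjacent to y) is injective on Y; it misses ∅ since Y ⊆ N(K), and the full set since K is maximal.
  ∣diverse∣+2≤2^classCount : ∀ {K Y} → IsMaximalClique G K → ∃ (λ v → v ∈ K) →
    IsDiverse G K Y → IsClassCount G K k → ∣ Y ∣ + 2 ≤ 2 ^ k
  ∣diverse∣+2≤2^classCount {k} {K} {Y} K-maximal (v , v∈K) (Y⊆N , Y-sep) (r , r∈K , _ , classOf) =
    injectiveOn-avoiding⇒∣p∣+2≤ Y (subsetToFin ∘ trace) (∅≢⊤ ∘ subsetToFin-injective)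
      (λ y∈Y → trace≢∅ y∈Y ∘ subsetToFin-injective , trace≢⊤ y∈Y ∘ subsetToFin-injective)
      (λ y₁∈Y y₂∈Y → trace-injectiveOn y₁∈Y y₂∈Y ∘ subsetToFin-injective)
    where
    trace : Fin n → Subset k
    trace y = tabulate (λ i → adj y (r i))

    Adj⇒∈trace : ∀ {y x} → y ∉ K → (x∈K : x ∈ K) → Adj G y x → proj₁ (classOf x x∈K) ∈ trace y
    Adj⇒∈trace {y} y∉K x∈K y~x = ∈-tabulate⁺ _
      (Adj-respʳ-Equiv (proj₂ (classOf _ x∈K)) (∈∧∉⇒≢ (r∈K _) y∉K ∘ sym) y~x)

    ∈trace⇒Adj : ∀ {y x} → y ∉ K → (x∈K : x ∈ K) → proj₁ (classOf x x∈K) ∈ trace y → Adj G y x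
    ∈trace⇒Adj y∉K x∈K i∈trace = Adj-respʳ-Equiv (Equiv-sym (proj₂ (classOf _ x∈K)))
      (∈∧∉⇒≢ x∈K y∉K ∘ sym) (∈-tabulate⁻ _ i∈trace)

    ∅≢⊤ : ∅ ≢ ⊤
    ∅≢⊤ e = ∉⊥ (subst (proj₁ (classOf v v∈K) ∈_) (sym e) ∈⊤)

    trace≢∅ : ∀ {y} → y ∈ Y → trace y ≢ ∅
    trace≢∅ {y} y∈Y e =
      let y∉K , x , x∈K , y~x = Y⊆N y y∈Y in ∉⊥ (subst (_ ∈_) e (Adj⇒∈trace y∉K x∈K y~x))

    trace≢⊤ : ∀ {y} → y ∈ Y → trace y ≢ ⊤
    trace≢⊤ {y} y∈Y e =
      let y∉K = proj₁ (Y⊆N y y∈Y)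
          x , x∈K , x≁y = maximalClique-∉⇒nonNeighbour K-maximal y∉K
      in x≁y (Adj-sym (∈trace⇒Adj y∉K x∈K (subst (_ ∈_) (sym e) ∈⊤)))

    trace≡⇒Adj⇒Adj : ∀ {y₁ y₂} → y₁ ∈ Y → y₂ ∈ Y → trace y₁ ≡ trace y₂ →
                     ∀ {x} → x ∈ K → Adj G y₁ x → Adj G y₂ x
    trace≡⇒Adj⇒Adj y₁∈Y y₂∈Y e x∈K = ∈trace⇒Adj (proj₁ (Y⊆N _ y₂∈Y)) x∈K
      ∘ subst (_ ∈_) e ∘ Adj⇒∈trace (proj₁ (Y⊆N _ y₁∈Y)) x∈K

    trace-injectiveOn : ∀ {y₁ y₂} → y₁ ∈ Y → y₂ ∈ Y → trace y₁ ≡ trace y₂ → y₁ ≡ y₂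
    trace-injectiveOn {y₁} {y₂} y₁∈Y y₂∈Y e with y₁ ≟ y₂
    ... | yes y₁≡y₂ = y₁≡y₂
    ... | no  y₁≢y₂ = ⊥-elim (Y-sep y₁ y₂ y₁∈Y y₂∈Y y₁≢y₂ λ x x∈K →
            trace≡⇒Adj⇒Adj y₁∈Y y₂∈Y e x∈K , trace≡⇒Adj⇒Adj y₂∈Y y₁∈Y (sym e) x∈K)

lemma7p1 : (n : ℕ) → 1 ≤ n → (G : Graph n) → (K : Subset n) → IsMaximalClique G K →
    (d k : ℕ) → IsDiversityNumber G K d → IsClassCount G K k →
    (d + 2 ≤ 2 ^ k) × (k ≤ 2 ^ d)
lemma7p1 (suc n) _ G K K-maximal .(∣ Y ∣) k ((Y , Y-diverse , refl) , Y-maximum) classes =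
  ∣diverse∣+2≤2^classCount G K-maximal (maximalClique-nonempty G K-maximal Fin.zero) Y-diverse classes ,
  classCount≤2^∣maximumDiverse∣ G K-maximal Y-diverse Y-maximum classes
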